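{- Let $G$ be a graph of order $n$ with minimum degree $\delta\ge1$, and let $k$ be an integer with $1-\lceil\delta/2\rceil\le k\le\lfloor\delta/2\rfloor$. Then $\mathcal{M}_k(G)=n$ if and only if $k=\lfloor\delta/2\rfloor$ and either (i) $\delta$ is even and every vertex of $G$ is adjacent to a vertex of degree $\delta$ or $\delta+1$, or (ii) $\delta$ is odd and every vertex of $G$ is adjacent to a vertex of degree $\delta$.
   Context: All graphs are finite and simple. For a vertex $v$, $\delta(v)$ is its degree and $\delta_X(v)=|N(v)\cap X|$. For an integer $k$ in the stated range, a nonempty set $M\subseteq V(G)$ is a $k$-monopoly if every vertex $v$ satisfies $\delta_M(v)\ge\frac{\delta(v)}{2}+k$; $\mathcal{M}_k(G)$ is the minimum cardinality of a $k$-monopoly. -}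

module Defs where

open import Data.Bool using (Bool; true; false)
open import Data.Nat using (ℕ; _≤_; _%_; ⌊_/2⌋; ⌈_/2⌉)
open import Data.Integer as ℤ using (ℤ; +_)
open import Data.Fin using (Fin)
open import Data.Fin.Subset using (Subset; _∩_; ∣_∣; Nonempty)
open import Data.Vec using (tabulate)
open import Data.Product using (Σ; ∃; _×_)
open import Data.Sum using (_⊎_)
open import Relation.Binary.PropositionalEquality using (_≡_)

record Graph (n : ℕ) : Set where
  field
    adj      : Fin n → Fin n → Bool
    symmetric : ∀ u v → adj u v ≡ adj v u
    irreflexive : ∀ v → adj v v ≡ false

module _ {n : ℕ} (G : Graph n) where
  open Graph G

  N : Fin n → Subset n
  N v = tabulate (adj v)

  deg : Fin n → ℕ
  deg v = ∣ N v ∣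

  degIn : Subset n → Fin n → ℕ
  degIn X v = ∣ N v ∩ X ∣

  IsMinDegree : ℕ → Set
  IsMinDegree δ = (∃ λ v → deg v ≡ δ) × (∀ v → δ ≤ deg v)

  -- M is a k-monopoly: nonempty and δ_M(v) ≥ δ(v)/2 + k for all v,
  -- written equivalently (multiplying by 2) over ℤ as 2 δ_M(v) ≥ δ(v) + 2k.
  IsMonopoly : ℤ → Subset n → Set
  IsMonopoly k M = Nonempty M ×
    (∀ v → (+ deg v) ℤ.+ (+ 2) ℤ.* k ℤ.≤ (+ 2) ℤ.* (+ degIn M v))

  IsMonopolyNumber : ℤ → ℕ → Set
  IsMonopolyNumber k m =
    (∃ λ M → IsMonopoly k M × ∣ M ∣ ≡ m) ×
    (∀ M → IsMonopoly k M → m ≤ ∣ M ∣)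

  AllAdjacentTo : (ℕ → Set) → Set
  AllAdjacentTo P = ∀ v → ∃ λ u → adj v u ≡ true × P (deg u)

-- V(G) is a k-monopoly whenever 2k ≤ δ, and k-monopolies are closed under
-- supersets, so 𝓜_k(G) = n exactly when no V − w is a k-monopoly.  Deleting w
-- lowers δ_X(v) by one for the neighbours v of w and leaves the other vertices
-- alone, so V − w fails precisely when some neighbour v of w has δ(v) ≤ 2k + 1.
-- Since 2⌊δ/2⌋ ≥ δ − 1 and δ ≤ δ(v), this forces k = ⌊δ/2⌋ and
-- δ(v) ≤ 2⌊δ/2⌋ + 1, which reads δ(v) ∈ {δ, δ + 1} for even δ and δ(v) = δ for odd δ.
module Submission where

open import Defs
open import Data.Nat using (ℕ; suc; _≤_; _%_; ⌊_/2⌋; ⌈_/2⌉)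
open import Data.Integer as ℤ using (ℤ; +_)
open import Data.Product using (_×_)
open import Data.Sum using (_⊎_)
open import Function.Bundles using (_⇔_)
open import Relation.Binary.PropositionalEquality using (_≡_)

open import Data.Bool using (true; false)
open import Data.Bool.Properties using (∧-zeroʳ; ∧-identityʳ)
open import Data.Nat using (_*_; s≤s⁻¹)
import Data.Fin as Fin
open import Data.Fin using (Fin)
open import Data.Fin.Properties using (all?; ¬∀⟶∃¬)
open import Data.Fin.Subset using (Subset; _∩_; ∣_∣; Nonempty; ⊤; _∈_; _∉_; _⊆_; _-_)
open import Data.Fin.Subset.Properties
  using (∈⊤; ∣⊤∣≡n; ∩-identityʳ; p─⊥≡p; x∈p∩q⁺; x∈p∩q⁻; p⊆q⇒∣p∣≤∣q∣; _∈?_;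
         x∈p⇒∣p-x∣<∣p∣; x∈p∧x≢y⇒x∈p-y)
open import Data.Integer.Properties as ℤ using ()
open import Data.Nat.Properties as ℕ using ()
open import Data.Product using (∃; _,_; proj₁; proj₂; map₂)
open import Data.Sum using (inj₁; inj₂)
open import Data.Vec using (_∷_; here; there)
open import Data.Vec.Properties using (lookup∘tabulate; lookup⇒[]=; []=⇒lookup)
open import Function.Base using (_∘_)
open import Function.Bundles using (mk⇔; Equivalence)
open import Function.Related.Propositional using (module EquationalReasoning)
open import Function.Construct.Composition using (_⇔-∘_)
open import Function.Construct.Identity using (⇔-id)
open import Data.Product.Function.NonDependent.Propositional using (_×-cong_)
open import Relation.Nullary using (¬_; yes; no; contradiction)
open import Relation.Binary.PropositionalEquality
  using (refl; sym; trans; cong; cong₂; subst; subst₂; module ≡-Reasoning)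

p∩[⊤-x]≡p-x : ∀ {n} (p : Subset n) x → p ∩ (⊤ - x) ≡ p - x
p∩[⊤-x]≡p-x (s ∷ p) Fin.zero =
  cong₂ _∷_ (∧-zeroʳ s) (trans (cong (p ∩_) (p─⊥≡p ⊤)) (trans (∩-identityʳ p) (sym (p─⊥≡p p))))
p∩[⊤-x]≡p-x (s ∷ p) (Fin.suc x) = cong₂ _∷_ (∧-identityʳ s) (p∩[⊤-x]≡p-x p x)

x∉p⇒p-x≡p : ∀ {n} {p : Subset n} {x} → x ∉ p → p - x ≡ p
x∉p⇒p-x≡p {p = false ∷ p} {Fin.zero} _ = cong (false ∷_) (p─⊥≡p p)
x∉p⇒p-x≡p {p = true ∷ p} {Fin.zero} x∉p = contradiction here x∉p
x∉p⇒p-x≡p {p = s ∷ p} {Fin.suc x} x∉p = cong (s ∷_) (x∉p⇒p-x≡p (λ x∈p → x∉p (there x∈p)))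

x∈p⇒suc∣p-x∣≡∣p∣ : ∀ {n} {p : Subset n} {x} → x ∈ p → suc ∣ p - x ∣ ≡ ∣ p ∣
x∈p⇒suc∣p-x∣≡∣p∣ {p = true ∷ p} here = cong (λ q → suc ∣ q ∣) (p─⊥≡p p)
x∈p⇒suc∣p-x∣≡∣p∣ {p = true ∷ p} (there x∈p) = cong suc (x∈p⇒suc∣p-x∣≡∣p∣ x∈p)
x∈p⇒suc∣p-x∣≡∣p∣ {p = false ∷ p} (there x∈p) = x∈p⇒suc∣p-x∣≡∣p∣ x∈p

x∉p⇒p⊆⊤-x : ∀ {n} {p : Subset n} {x} → x ∉ p → p ⊆ ⊤ - x
x∉p⇒p⊆⊤-x x∉p y∈p = x∈p∧x≢y⇒x∈p-y ∈⊤ (λ { refl → x∉p y∈p })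

∩-monoʳ-⊆ : ∀ {n} (p : Subset n) {q r} → q ⊆ r → p ∩ q ⊆ p ∩ r
∩-monoʳ-⊆ p {q} q⊆r x∈p∩q with x∈p∩q⁻ p q x∈p∩q
... | x∈p , x∈q = x∈p∩q⁺ (x∈p , q⊆r x∈q)

1≤∣p∣⇒Nonempty : ∀ {n} {p : Subset n} → 1 ≤ ∣ p ∣ → Nonempty p
1≤∣p∣⇒Nonempty {p = true ∷ p} _ = Fin.zero , here
1≤∣p∣⇒Nonempty {p = false ∷ p} 1≤∣p∣ with 1≤∣p∣⇒Nonempty 1≤∣p∣
... | x , x∈p = Fin.suc x , there x∈p

+-cancelˡ-≤ : ∀ i {j k} → i ℤ.+ j ℤ.≤ i ℤ.+ k → j ℤ.≤ k
+-cancelˡ-≤ i {j} {k} i+j≤i+k =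
  subst₂ ℤ._≤_ (-i+[i+m]≡m j) (-i+[i+m]≡m k) (ℤ.+-monoʳ-≤ (ℤ.- i) i+j≤i+k)
  where
  -i+[i+m]≡m : ∀ m → ℤ.- i ℤ.+ (i ℤ.+ m) ≡ m
  -i+[i+m]≡m m = begin
    ℤ.- i ℤ.+ (i ℤ.+ m)  ≡⟨ sym (ℤ.+-assoc (ℤ.- i) i m) ⟩
    ℤ.- i ℤ.+ i ℤ.+ m    ≡⟨ cong (ℤ._+ m) (ℤ.+-inverseˡ i) ⟩
    ℤ.0ℤ ℤ.+ m           ≡⟨ ℤ.+-identityˡ m ⟩
    m                    ∎
    where open ≡-Reasoning

2*i≡i+i : ∀ i → + 2 ℤ.* i ≡ i ℤ.+ i
2*i≡i+i i = trans (ℤ.suc-* (+ 1) i) (cong (ℤ._+_ i) (ℤ.*-identityˡ i))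

j≤i⇒i+j≤2*i : ∀ {i j} → j ℤ.≤ i → i ℤ.+ j ℤ.≤ + 2 ℤ.* i
j≤i⇒i+j≤2*i {i} j≤i = subst (i ℤ.+ _ ℤ.≤_) (sym (2*i≡i+i i)) (ℤ.+-monoʳ-≤ i j≤i)

[1+i]+j≤2*i⇔1+j≤i : ∀ i j → (+ 1 ℤ.+ i) ℤ.+ j ℤ.≤ + 2 ℤ.* i ⇔ + 1 ℤ.+ j ℤ.≤ i
[1+i]+j≤2*i⇔1+j≤i i j = mk⇔
  (λ le → +-cancelˡ-≤ i (subst₂ ℤ._≤_ regroup (2*i≡i+i i) le))
  (λ le → subst₂ ℤ._≤_ (sym regroup) (sym (2*i≡i+i i)) (ℤ.+-monoʳ-≤ i le))
  where
  regroup : (+ 1 ℤ.+ i) ℤ.+ j ≡ i ℤ.+ (+ 1 ℤ.+ j)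
  regroup = trans (cong (ℤ._+ j) (ℤ.+-comm (+ 1) i)) (ℤ.+-assoc i (+ 1) j)

2*i≤1+2*j⇒i≤j : ∀ {i j} → + 2 ℤ.* i ℤ.≤ + 1 ℤ.+ + 2 ℤ.* j → i ℤ.≤ j
2*i≤1+2*j⇒i≤j {i} {j} le = subst (i ℤ.≤_) (ℤ.pred-suc j) (ℤ.i<j⇒i≤pred[j] i<1+j)
  where
  i<1+j : i ℤ.< + 1 ℤ.+ j
  i<1+j = ℤ.*-cancelˡ-<-nonNeg (+ 2) (begin-strict
    + 2 ℤ.* i             ≤⟨ le ⟩
    + 1 ℤ.+ + 2 ℤ.* j     <⟨ ℤ.+-monoˡ-< (+ 2 ℤ.* j) (ℤ.+<+ ℕ.≤-refl) ⟩
    + 2 ℤ.+ + 2 ℤ.* j     ≡⟨ sym (ℤ.*-distribˡ-+ (+ 2) (+ 1) j) ⟩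
    + 2 ℤ.* (+ 1 ℤ.+ j)   ∎)
    where open ℤ.≤-Reasoning

⌊n/2⌋-parity : ∀ n → (n % 2 ≡ 0 × n ≡ 2 * ⌊ n /2⌋) ⊎ (n % 2 ≡ 1 × n ≡ suc (2 * ⌊ n /2⌋))
⌊n/2⌋-parity 0 = inj₁ (refl , refl)
⌊n/2⌋-parity 1 = inj₂ (refl , refl)
⌊n/2⌋-parity (suc (suc n)) with ⌊n/2⌋-parity n
... | inj₁ (n%2≡0 , n≡2h) =
  inj₁ (n%2≡0 , trans (cong (λ m → suc (suc m)) n≡2h) (sym (ℕ.*-suc 2 ⌊ n /2⌋)))
... | inj₂ (n%2≡1 , n≡1+2h) =
  inj₂ (n%2≡1 , trans (cong (λ m → suc (suc m)) n≡1+2h) (cong suc (sym (ℕ.*-suc 2 ⌊ n /2⌋))))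

2*⌊n/2⌋≤n : ∀ n → 2 * ⌊ n /2⌋ ≤ n
2*⌊n/2⌋≤n n with ⌊n/2⌋-parity n
... | inj₁ (_ , n≡2h) = ℕ.≤-reflexive (sym n≡2h)
... | inj₂ (_ , n≡1+2h) = ℕ.≤-trans (ℕ.n≤1+n _) (ℕ.≤-reflexive (sym n≡1+2h))

m≤n⇒[n≤m⇔n≡m] : ∀ {m n} → m ≤ n → n ≤ m ⇔ n ≡ m
m≤n⇒[n≤m⇔n≡m] m≤n = mk⇔ (λ n≤m → ℕ.≤-antisym n≤m m≤n) ℕ.≤-reflexive

m≤n⇒[n≤1+m⇔n≡m⊎n≡1+m] : ∀ {m n} → m ≤ n → n ≤ suc m ⇔ (n ≡ m ⊎ n ≡ suc m)
m≤n⇒[n≤1+m⇔n≡m⊎n≡1+m] {m} {n} m≤n = mk⇔ to from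
  where
  to : n ≤ suc m → n ≡ m ⊎ n ≡ suc m
  to n≤1+m with ℕ.m≤n⇒m<n∨m≡n n≤1+m
  ... | inj₁ n<1+m = inj₁ (ℕ.≤-antisym (s≤s⁻¹ n<1+m) m≤n)
  ... | inj₂ n≡1+m = inj₂ n≡1+m
  from : n ≡ m ⊎ n ≡ suc m → n ≤ suc m
  from (inj₁ refl) = ℕ.n≤1+n _
  from (inj₂ refl) = ℕ.≤-refl

+1+2*+m≡+[1+2*m] : ∀ m → + 1 ℤ.+ + 2 ℤ.* + m ≡ + suc (2 * m)
+1+2*+m≡+[1+2*m] m = cong (ℤ._+_ (+ 1)) (sym (ℤ.pos-* 2 m))

+d≤1+2k⇔k≡⌊δ/2⌋×d≤1+2⌊δ/2⌋ : ∀ {δ d} k → δ ≤ d → k ℤ.≤ + ⌊ δ /2⌋ →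
  + d ℤ.≤ + 1 ℤ.+ + 2 ℤ.* k ⇔ (k ≡ + ⌊ δ /2⌋ × d ≤ suc (2 * ⌊ δ /2⌋))
+d≤1+2k⇔k≡⌊δ/2⌋×d≤1+2⌊δ/2⌋ {δ} {d} k δ≤d k≤h = mk⇔ to from
  where
  h : ℕ
  h = ⌊ δ /2⌋
  to : + d ℤ.≤ + 1 ℤ.+ + 2 ℤ.* k → k ≡ + h × d ≤ suc (2 * h)
  to d≤1+2k = k≡h , ℤ.drop‿+≤+ (subst (+ d ℤ.≤_) 1+2k≡+[1+2h] d≤1+2k)
    where
    2h≤d : + 2 ℤ.* + h ℤ.≤ + d
    2h≤d = subst (ℤ._≤ + d) (ℤ.pos-* 2 h) (ℤ.+≤+ (ℕ.≤-trans (2*⌊n/2⌋≤n δ) δ≤d))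
    k≡h : k ≡ + h
    k≡h = ℤ.≤-antisym k≤h (2*i≤1+2*j⇒i≤j (ℤ.≤-trans 2h≤d d≤1+2k))
    1+2k≡+[1+2h] : + 1 ℤ.+ + 2 ℤ.* k ≡ + suc (2 * h)
    1+2k≡+[1+2h] = trans (cong (λ i → + 1 ℤ.+ + 2 ℤ.* i) k≡h) (+1+2*+m≡+[1+2*m] h)
  from : k ≡ + h × d ≤ suc (2 * h) → + d ℤ.≤ + 1 ℤ.+ + 2 ℤ.* k
  from (refl , d≤1+2h) = subst (+ d ℤ.≤_) (sym (+1+2*+m≡+[1+2*m] h)) (ℤ.+≤+ d≤1+2h)

[1+i]+j≰2*i⇔1+i≤1+j : ∀ i j → (¬ ((+ 1 ℤ.+ i) ℤ.+ j ℤ.≤ + 2 ℤ.* i)) ⇔ + 1 ℤ.+ i ℤ.≤ + 1 ℤ.+ j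
[1+i]+j≰2*i⇔1+i≤1+j i j = mk⇔
  (λ ≰ → ℤ.i<j⇒suc[i]≤j (ℤ.≰⇒> (λ 1+j≤i → ≰ (from 1+j≤i))))
  (λ 1+i≤1+j ≤ → ℤ.<⇒≱ (ℤ.suc[i]≤j⇒i<j 1+i≤1+j) (to ≤))
  where open Equivalence ([1+i]+j≤2*i⇔1+j≤i i j)

module _ {n : ℕ} (G : Graph n) where
  open Graph G

  MonopolyCondition : ℤ → Subset n → Fin n → Set
  MonopolyCondition k X v = + deg G v ℤ.+ + 2 ℤ.* k ℤ.≤ + 2 ℤ.* + degIn G X v

  ∈N⇒adj : ∀ {v w} → w ∈ N G v → adj v w ≡ true
  ∈N⇒adj {v} {w} w∈Nv = trans (sym (lookup∘tabulate (adj v) w)) ([]=⇒lookup w∈Nv)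

  adj⇒∈N : ∀ {v w} → adj v w ≡ true → w ∈ N G v
  adj⇒∈N {v} {w} vw = lookup⇒[]= w (N G v) (trans (lookup∘tabulate (adj v) w) vw)

  degIn-⊤ : ∀ v → degIn G ⊤ v ≡ deg G v
  degIn-⊤ v = cong ∣_∣ (∩-identityʳ (N G v))

  degIn[⊤-w]-nonadjacent : ∀ {v w} → adj v w ≡ false → degIn G (⊤ - w) v ≡ deg G v
  degIn[⊤-w]-nonadjacent {v} {w} vw =
    trans (cong ∣_∣ (p∩[⊤-x]≡p-x (N G v) w)) (cong ∣_∣ (x∉p⇒p-x≡p w∉Nv))
    where
    w∉Nv : w ∉ N G v
    w∉Nv w∈Nv = contradiction (trans (sym vw) (∈N⇒adj w∈Nv)) λ ()

  degIn[⊤-w]-adjacent : ∀ {v w} → adj v w ≡ true → suc (degIn G (⊤ - w) v) ≡ deg G v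
  degIn[⊤-w]-adjacent {v} {w} vw =
    trans (cong (λ p → suc ∣ p ∣) (p∩[⊤-x]≡p-x (N G v) w)) (x∈p⇒suc∣p-x∣≡∣p∣ (adj⇒∈N vw))

  degIn-mono : ∀ {X Y} v → X ⊆ Y → degIn G X v ≤ degIn G Y v
  degIn-mono v X⊆Y = p⊆q⇒∣p∣≤∣q∣ (∩-monoʳ-⊆ (N G v) X⊆Y)

  IsMonopoly-mono : ∀ k {X Y} → X ⊆ Y → IsMonopoly G k X → IsMonopoly G k Y
  IsMonopoly-mono _ X⊆Y ((x , x∈X) , satisfied) =
    (x , X⊆Y x∈X) ,
    λ v → ℤ.≤-trans (satisfied v) (ℤ.*-monoˡ-≤-nonNeg (+ 2) (ℤ.+≤+ (degIn-mono v X⊆Y)))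

  fullDegree⇒MonopolyCondition : ∀ k {X v} → degIn G X v ≡ deg G v → + 2 ℤ.* k ℤ.≤ + deg G v →
    MonopolyCondition k X v
  fullDegree⇒MonopolyCondition k {X} {v} full 2k≤deg =
    subst (λ x → + deg G v ℤ.+ + 2 ℤ.* k ℤ.≤ + 2 ℤ.* + x) (sym full) (j≤i⇒i+j≤2*i 2k≤deg)

  ⊤-isMonopoly : ∀ k → Fin n → (∀ v → + 2 ℤ.* k ℤ.≤ + deg G v) → IsMonopoly G k ⊤
  ⊤-isMonopoly k v₀ 2k≤deg =
    (v₀ , ∈⊤) , λ v → fullDegree⇒MonopolyCondition k (degIn-⊤ v) (2k≤deg v)

  ¬MonopolyCondition[⊤-w]⇔ : ∀ k {v w} → adj v w ≡ true →
    (¬ MonopolyCondition k (⊤ - w) v) ⇔ + deg G v ℤ.≤ + 1 ℤ.+ + 2 ℤ.* k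
  ¬MonopolyCondition[⊤-w]⇔ k {v} {w} vw =
    subst (λ d → (¬ (+ d ℤ.+ + 2 ℤ.* k ℤ.≤ + 2 ℤ.* + e)) ⇔ + d ℤ.≤ + 1 ℤ.+ + 2 ℤ.* k)
          (degIn[⊤-w]-adjacent vw) ([1+i]+j≰2*i⇔1+i≤1+j (+ e) (+ 2 ℤ.* k))
    where
    e : ℕ
    e = degIn G (⊤ - w) v

  isMonopolyNumber-order⇔ : ∀ k → IsMonopoly G k ⊤ →
    IsMonopolyNumber G k n ⇔ (∀ w → ¬ IsMonopoly G k (⊤ - w))
  isMonopolyNumber-order⇔ k ⊤-monopoly = mk⇔ to from
    where
    to : IsMonopolyNumber G k n → ∀ w → ¬ IsMonopoly G k (⊤ - w)
    to (_ , minimal) w ⊤-w-monopoly =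
      ℕ.<⇒≱ (x∈p⇒∣p-x∣<∣p∣ {x = w} ∈⊤)
            (subst (_≤ ∣ ⊤ - w ∣) (sym (∣⊤∣≡n n)) (minimal (⊤ - w) ⊤-w-monopoly))
    from : (∀ w → ¬ IsMonopoly G k (⊤ - w)) → IsMonopolyNumber G k n
    from noneDeleted = (⊤ , ⊤-monopoly , ∣⊤∣≡n n) , minimal
      where
      minimal : ∀ M → IsMonopoly G k M → n ≤ ∣ M ∣
      minimal M M-monopoly with all? (_∈? M)
      ... | yes ⊤⊆M = subst (_≤ ∣ M ∣) (∣⊤∣≡n n) (p⊆q⇒∣p∣≤∣q∣ {p = ⊤} (λ {x} _ → ⊤⊆M x))
      ... | no ⊤⊈M with ¬∀⟶∃¬ n (_∈ M) (_∈? M) ⊤⊈M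
      ...   | w , w∉M = contradiction (IsMonopoly-mono k (x∉p⇒p⊆⊤-x w∉M) M-monopoly) (noneDeleted w)

  ¬IsMonopoly[⊤-w]⇔ : ∀ k {w} → (∀ v → + 2 ℤ.* k ℤ.≤ + deg G v) → Nonempty (⊤ - w) →
    (¬ IsMonopoly G k (⊤ - w)) ⇔ ∃ λ v → adj w v ≡ true × + deg G v ℤ.≤ + 1 ℤ.+ + 2 ℤ.* k
  ¬IsMonopoly[⊤-w]⇔ k {w} 2k≤deg nonempty = mk⇔ to from
    where
    to : ¬ IsMonopoly G k (⊤ - w) → ∃ λ v → adj w v ≡ true × + deg G v ℤ.≤ + 1 ℤ.+ + 2 ℤ.* k
    to ¬monopoly with ¬∀⟶∃¬ n (MonopolyCondition k (⊤ - w)) (λ v → _ ℤ.≤? _)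
                                (λ satisfied → ¬monopoly (nonempty , satisfied))
    ... | v , violated with adj v w in vw
    ...   | false =
      contradiction (fullDegree⇒MonopolyCondition k (degIn[⊤-w]-nonadjacent vw) (2k≤deg v)) violated
    ...   | true = v , trans (symmetric w v) vw , Equivalence.to (¬MonopolyCondition[⊤-w]⇔ k vw) violated
    from : (∃ λ v → adj w v ≡ true × + deg G v ℤ.≤ + 1 ℤ.+ + 2 ℤ.* k) → ¬ IsMonopoly G k (⊤ - w)
    from (v , wv , low) (_ , satisfied) =
      Equivalence.from (¬MonopolyCondition[⊤-w]⇔ k (trans (symmetric v w) wv)) low (satisfied v)

  noVertexDeletedMonopoly⇔ : ∀ k → (∀ v → + 2 ℤ.* k ℤ.≤ + deg G v) → (∀ w → Nonempty (⊤ - w)) →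
    (∀ w → ¬ IsMonopoly G k (⊤ - w)) ⇔ AllAdjacentTo G (λ d → + d ℤ.≤ + 1 ℤ.+ + 2 ℤ.* k)
  noVertexDeletedMonopoly⇔ k 2k≤deg nonempty = mk⇔
    (λ none w → Equivalence.to (deleted⇔ w) (none w))
    (λ adjacentToLow w → Equivalence.from (deleted⇔ w) (adjacentToLow w))
    where
    deleted⇔ : ∀ w → (¬ IsMonopoly G k (⊤ - w)) ⇔
      ∃ λ v → adj w v ≡ true × + deg G v ℤ.≤ + 1 ℤ.+ + 2 ℤ.* k
    deleted⇔ w = ¬IsMonopoly[⊤-w]⇔ k 2k≤deg (nonempty w)

  AllAdjacentTo-map : ∀ {P Q : ℕ → Set} → (∀ v → P (deg G v) → Q (deg G v)) →
    AllAdjacentTo G P → AllAdjacentTo G Q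
  AllAdjacentTo-map P⇒Q adjacentToP v = map₂ (map₂ (P⇒Q _)) (adjacentToP v)

  AllAdjacentTo-cong : ∀ {P Q : ℕ → Set} → (∀ v → P (deg G v) ⇔ Q (deg G v)) →
    AllAdjacentTo G P ⇔ AllAdjacentTo G Q
  AllAdjacentTo-cong {P} {Q} P⇔Q = mk⇔
    (AllAdjacentTo-map {P} {Q} (Equivalence.to ∘ P⇔Q))
    (AllAdjacentTo-map {Q} {P} (Equivalence.from ∘ P⇔Q))

  AllAdjacentTo-× : ∀ {A : Set} {P : ℕ → Set} → Fin n →
    AllAdjacentTo G (λ d → A × P d) ⇔ (A × AllAdjacentTo G P)
  AllAdjacentTo-× {A} {P} v₀ = mk⇔
    (λ adjacentToA×P → proj₁ (proj₂ (proj₂ (adjacentToA×P v₀))) ,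
                       AllAdjacentTo-map {λ d → A × P d} {P} (λ _ → proj₂) adjacentToA×P)
    (λ (a , adjacentToP) → AllAdjacentTo-map {P} {λ d → A × P d} (λ _ → a ,_) adjacentToP)

module _ {n : ℕ} (G : Graph n) {δ : ℕ} (minDegree : IsMinDegree G δ) where
  open Graph G

  δ≤deg : ∀ v → δ ≤ deg G v
  δ≤deg = proj₂ minDegree

  2k≤deg : ∀ {k} → k ℤ.≤ + ⌊ δ /2⌋ → ∀ v → + 2 ℤ.* k ℤ.≤ + deg G v
  2k≤deg k≤h v = ℤ.≤-trans (ℤ.*-monoˡ-≤-nonNeg (+ 2) k≤h)
    (subst (ℤ._≤ + deg G v) (ℤ.pos-* 2 ⌊ δ /2⌋) (ℤ.+≤+ (ℕ.≤-trans (2*⌊n/2⌋≤n δ) (δ≤deg v))))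

  ⊤-w-nonempty : 1 ≤ δ → ∀ w → Nonempty (⊤ - w)
  ⊤-w-nonempty 1≤δ w with 1≤∣p∣⇒Nonempty {p = N G w} (ℕ.≤-trans 1≤δ (δ≤deg w))
  ... | u , u∈Nw = u , x∈p∧x≢y⇒x∈p-y ∈⊤ λ { refl →
    contradiction (trans (sym (irreflexive w)) (∈N⇒adj G u∈Nw)) λ () }

  AllAdjacentTo-lowDegree⇔ : ∀ {k} → Fin n → k ℤ.≤ + ⌊ δ /2⌋ →
    AllAdjacentTo G (λ d → + d ℤ.≤ + 1 ℤ.+ + 2 ℤ.* k) ⇔
    (k ≡ + ⌊ δ /2⌋ × AllAdjacentTo G (λ d → d ≤ suc (2 * ⌊ δ /2⌋)))
  AllAdjacentTo-lowDegree⇔ {k} v₀ k≤h =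
    AllAdjacentTo-× G {k ≡ + ⌊ δ /2⌋} {λ d → d ≤ suc (2 * ⌊ δ /2⌋)} v₀ ⇔-∘
    AllAdjacentTo-cong G {λ d → + d ℤ.≤ + 1 ℤ.+ + 2 ℤ.* k} {λ d → k ≡ + ⌊ δ /2⌋ × d ≤ suc (2 * ⌊ δ /2⌋)}
      (λ v → +d≤1+2k⇔k≡⌊δ/2⌋×d≤1+2⌊δ/2⌋ k (δ≤deg v) k≤h)

  AllAdjacentTo-≤1+2⌊δ/2⌋⇔ : AllAdjacentTo G (λ d → d ≤ suc (2 * ⌊ δ /2⌋)) ⇔
    ((δ % 2 ≡ 0 × AllAdjacentTo G (λ d → d ≡ δ ⊎ d ≡ suc δ))
     ⊎ (δ % 2 ≡ 1 × AllAdjacentTo G (λ d → d ≡ δ)))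
  AllAdjacentTo-≤1+2⌊δ/2⌋⇔ with ⌊n/2⌋-parity δ
  ... | inj₁ (δ%2≡0 , δ≡2h) = mk⇔
    (λ low → inj₁ (δ%2≡0 , Equivalence.to bound⇔ low))
    λ { (inj₁ (_ , adjacent)) → Equivalence.from bound⇔ adjacent
      ; (inj₂ (δ%2≡1 , _)) → contradiction (trans (sym δ%2≡0) δ%2≡1) λ () }
    where
    bound⇔ : AllAdjacentTo G (λ d → d ≤ suc (2 * ⌊ δ /2⌋)) ⇔
             AllAdjacentTo G (λ d → d ≡ δ ⊎ d ≡ suc δ)
    bound⇔ = AllAdjacentTo-cong G {λ d → d ≤ suc (2 * ⌊ δ /2⌋)} {λ d → d ≡ δ ⊎ d ≡ suc δ} λ v →
      subst (λ m → deg G v ≤ suc m ⇔ (deg G v ≡ δ ⊎ deg G v ≡ suc δ)) δ≡2h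
            (m≤n⇒[n≤1+m⇔n≡m⊎n≡1+m] (δ≤deg v))
  ... | inj₂ (δ%2≡1 , δ≡1+2h) = mk⇔
    (λ low → inj₂ (δ%2≡1 , Equivalence.to bound⇔ low))
    λ { (inj₁ (δ%2≡0 , _)) → contradiction (trans (sym δ%2≡0) δ%2≡1) λ ()
      ; (inj₂ (_ , adjacent)) → Equivalence.from bound⇔ adjacent }
    where
    bound⇔ : AllAdjacentTo G (λ d → d ≤ suc (2 * ⌊ δ /2⌋)) ⇔ AllAdjacentTo G (λ d → d ≡ δ)
    bound⇔ = AllAdjacentTo-cong G {λ d → d ≤ suc (2 * ⌊ δ /2⌋)} {λ d → d ≡ δ} λ v →
      subst (λ m → deg G v ≤ m ⇔ deg G v ≡ δ) δ≡1+2h (m≤n⇒[n≤m⇔n≡m] (δ≤deg v))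

proposition12 : (n : ℕ) (G : Graph n) (δ : ℕ) → IsMinDegree G δ → 1 ≤ δ →
    (k : ℤ) → (+ 1) ℤ.- (+ ⌈ δ /2⌉) ℤ.≤ k → k ℤ.≤ (+ ⌊ δ /2⌋) →
      IsMonopolyNumber G k n ⇔
        (k ≡ (+ ⌊ δ /2⌋) ×
          ((δ % 2 ≡ 0 × AllAdjacentTo G (λ d → d ≡ δ ⊎ d ≡ suc δ))
           ⊎ (δ % 2 ≡ 1 × AllAdjacentTo G (λ d → d ≡ δ))))
-- The lower bound on k is the paper's standing range for k; the argument never uses it.
proposition12 n G δ minDegree 1≤δ k _ k≤h =
  IsMonopolyNumber G k n
    ∼⟨ isMonopolyNumber-order⇔ G k (⊤-isMonopoly G k v₀ 2k≤degree) ⟩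
  (∀ w → ¬ IsMonopoly G k (⊤ - w))
    ∼⟨ noVertexDeletedMonopoly⇔ G k 2k≤degree (⊤-w-nonempty G minDegree 1≤δ) ⟩
  AllAdjacentTo G (λ d → + d ℤ.≤ + 1 ℤ.+ + 2 ℤ.* k)
    ∼⟨ AllAdjacentTo-lowDegree⇔ G minDegree v₀ k≤h ⟩
  (k ≡ + ⌊ δ /2⌋ × AllAdjacentTo G (λ d → d ≤ suc (2 * ⌊ δ /2⌋)))
    ∼⟨ ⇔-id _ ×-cong AllAdjacentTo-≤1+2⌊δ/2⌋⇔ G minDegree ⟩
  _ ∎
  where
  open EquationalReasoning
  v₀ : Fin n
  v₀ = proj₁ (proj₁ minDegree)
  2k≤degree : ∀ v → + 2 ℤ.* k ℤ.≤ + deg G v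
  2k≤degree = 2k≤deg G minDegree k≤h
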